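{- Let $T_n$ be the set of compatible pairs on the maximal Dyck path $\mathcal{D}^{(n+1)\times n}$. Then for $n>1$, $|T_n|=3|T_{n-1}|-|T_{n-2}|$. In particular, the number of compatible pairs on $\mathcal{D}^{(n+1)\times n}$ is $F_{2n+3}$ for every $n\ge0$.
   Context: $\mathcal{D}=\mathcal{D}^{(n+1)\times n}$ is the lattice path from $(0,0)$ to $(n+1,n)$ with vertices $A_0=(0,0)$, $A_1=B_0=(1,0)$, and for $1\le i\le n$, $B_i=(i+1,i-1)$, $A_{i+1}=(i+1,i)$ (the highest unit up/right path not going strictly above the segment from $(0,0)$ to $(n+1,n)$). Horizontal edges $u_i=A_iB_i$ ($0\le i\le n$), $\mathcal{D}_1=\{u_0,\dots,u_n\}$; vertical edges $v_j=B_jA_{j+1}$ ($1\le j\le n$), $\mathcal{D}_2=\{v_1,\dots,v_n\}$. Identify $(n+1,n)$ with $(0,0)$. For lattice points $P,Q$ the subpath $PQ$ goes from $P$ northeast along $\mathcal{D}$ to $Q$, looping from $(n+1,n)$ to $(0,0)$ if needed (if $P=Q$, the full loop); $(PQ)_1,(PQ)_2$ are its horizontal/vertical edges, $(PQ)^\circ$ its lattice points other than $P,Q$. A pair $(S_1,S_2)$ with $S_1\subseteq\mathcal{D}_1$, $S_2\subseteq\mathcal{D}_2$ is compatible if for all $u\in S_1$, $v\in S_2$, with $E$ the left endpoint of $u$ and $F$ the upper endpoint of $v$, there is $A\in(EF)^\circ$ with $|(AF)_1|=2|(AF)_2\cap S_2|$ or $|(EA)_2|=2|(EA)_1\cap S_1|$.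 Fibonacci numbers: $F_1=F_2=1$, $F_{m+1}=F_m+F_{m-1}$. -}

module Defs where

open import Data.Nat using (ℕ; zero; suc; _+_; _*_; _∸_; _≤_; _≤?_; _<_; _%_)
open import Data.Nat.Properties using (_≟_)
open import Data.Bool using (Bool; true; false; if_then_else_)
import Data.Bool.Properties as BoolP
open import Data.Fin using (Fin; zero; suc; toℕ)
open import Data.Fin.Properties using (any?; all?)
open import Data.Vec using (Vec; []; _∷_; lookup)
open import Data.List using (List; []; _∷_; _++_; take; drop; length; filter; concatMap; cartesianProduct; allFin)
open import Data.Product using (Σ; ∃; _×_; _,_; proj₁; proj₂)
open import Data.Sum using (_⊎_)
open import Relation.Binary.PropositionalEquality using (_≡_)
open import Relation.Nullary using (Dec; does)
open import Relation.Nullary.Decidable using (_×-dec_; _⊎-dec_; _→-dec_)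

fib : ℕ → ℕ
fib zero = zero
fib (suc zero) = 1
fib (suc (suc m)) = fib (suc m) + fib m

-- Edges of the maximal Dyck path D^{(n+1)×n}.
--   hor i      is  u_i        (0 ≤ i ≤ n)
--   ver j      is  v_{j+1}    (0 ≤ j < n, i.e. v_1 … v_n)
data Edge (n : ℕ) : Set where
  hor : Fin (suc n) → Edge n
  ver : Fin n → Edge n

-- Number of edges = number of distinct lattice points on the closed loop
-- (after identifying (n+1,n) with (0,0)).
N : ℕ → ℕ
N n = suc (2 * n)

-- The edges of D listed in northeast order:  u_0, u_1, v_1, u_2, v_2, …, u_n, v_n.
-- Lattice points of D are numbered 0 … N n - 1 in the same order
-- (point p is the starting point of edge number p; point 0 = (0,0) = (n+1,n)).
pathEdges : (n : ℕ) → List (Edge n)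
pathEdges n = hor zero ∷ concatMap (λ j → hor (suc j) ∷ ver j ∷ []) (allFin n)

-- Edges of the subpath starting at point s and consisting of len edges
-- (wrapping around from (n+1,n) to (0,0)); used with s < N n and len ≤ N n.
subpath : (n : ℕ) → ℕ → ℕ → List (Edge n)
subpath n s len = take len (drop s (pathEdges n ++ pathEdges n))

-- Number of edges of the subpath PQ from point p to point q (a full loop if p = q).
loopLen : (n : ℕ) → ℕ → ℕ → ℕ
loopLen n p q with (q + N n ∸ p) % N n
... | zero = N n
... | suc d = suc d

-- Left endpoint E of u_i, and upper endpoint F of v_{j+1}, as point numbers.
leftEnd : {n : ℕ} → Fin (suc n) → ℕ
leftEnd zero = 0
leftEnd (suc j) = suc (2 * toℕ j)

upperEnd : {n : ℕ} → Fin n → ℕ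
upperEnd {n} j = (3 + 2 * toℕ j) % N n

isH : {n : ℕ} → Edge n → Bool
isH (hor _) = true
isH (ver _) = false

isV : {n : ℕ} → Edge n → Bool
isV (hor _) = false
isV (ver _) = true

inS₁ : {n : ℕ} → Vec Bool (suc n) → Edge n → Bool
inS₁ S₁ (hor i) = lookup S₁ i
inS₁ S₁ (ver _) = false

inS₂ : {n : ℕ} → Vec Bool n → Edge n → Bool
inS₂ S₂ (hor _) = false
inS₂ S₂ (ver j) = lookup S₂ j

count : {A : Set} → (A → Bool) → List A → ℕ
count f [] = 0
count f (x ∷ xs) = (if f x then 1 else 0) + count f xs

-- Subsets S₁ ⊆ D₁ = {u_0,…,u_n} as Vec Bool (n+1) (entry i ↔ u_i),
-- S₂ ⊆ D₂ = {v_1,…,v_n} as Vec Bool n (entry j ↔ v_{j+1}).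
-- Condition for a fixed u = u_i ∈ S₁, v = v_{j+1} ∈ S₂, with E = leftEnd i, F = upperEnd j,
-- and A the point at offset k (1 ≤ k < |EF|) from E along EF (so A ∈ (EF)°):
--   |(AF)₁| = 2 |(AF)₂ ∩ S₂|   or   |(EA)₂| = 2 |(EA)₁ ∩ S₁|.
PointCond : (n : ℕ) → Vec Bool (suc n) → Vec Bool n → Fin (suc n) → Fin n → ℕ → Set
PointCond n S₁ S₂ i j k =
  let E = leftEnd i
      F = upperEnd j
      L = loopLen n E F
      A = (E + k) % N n
      AF = subpath n A (L ∸ k)
      EA = subpath n E k
  in  (count isH AF ≡ 2 * count (inS₂ S₂) AF)
    ⊎ (count isV EA ≡ 2 * count (inS₁ S₁) EA)

Compatible : (n : ℕ) → Vec Bool (suc n) → Vec Bool n → Set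
Compatible n S₁ S₂ =
  ∀ (i : Fin (suc n)) (j : Fin n) → lookup S₁ i ≡ true → lookup S₂ j ≡ true →
    ∃ λ (k : Fin (loopLen n (leftEnd i) (upperEnd j))) →
      1 ≤ toℕ k × PointCond n S₁ S₂ i j (toℕ k)

compatible? : (n : ℕ) (S₁ : Vec Bool (suc n)) (S₂ : Vec Bool n) → Dec (Compatible n S₁ S₂)
compatible? n S₁ S₂ =
  all? λ i → all? λ j →
    (lookup S₁ i BoolP.≟ true) →-dec ((lookup S₂ j BoolP.≟ true) →-dec
      any? λ k → (1 ≤? toℕ k) ×-dec
        ((_ ≟ _) ⊎-dec (_ ≟ _)))

allVecs : (m : ℕ) → List (Vec Bool m)
allVecs zero = [] ∷ []
allVecs (suc m) = concatMap (λ v → (false ∷ v) ∷ (true ∷ v) ∷ []) (allVecs m)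

numCompatible : ℕ → ℕ
numCompatible n =
  length (filter (λ p → compatible? n (proj₁ p) (proj₂ p))
                 (cartesianProduct (allVecs (suc n)) (allVecs n)))

-- A pair (S₁, S₂) is compatible exactly when no v_{j+1} ∈ S₂ has u_j or u_{j+1} in S₁.
-- For such a clash the subpath EF has at most one horizontal and one vertical edge besides
-- u and v, too few for either equation to hold at an interior point A. Without clashes, cut EF
-- into steps u_t v_t. If the interior of EF has many vertical edges compared with S₁, then
-- |(EA)₂| − 2|(EA)₁ ∩ S₁| climbs from negative to nonnegative by at most one per edge, so it
-- vanishes at some A; symmetrically for horizontal edges, S₂ and AF. If neither, EF would carry
-- more edges of S₁ ∪ S₂ than it has steps minus one, impossible since a step carries at most one
-- of them and an S₁-step is never followed by an S₂-step. Counting clash-free pairs by whether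
-- u₀ ∈ S₁ gives F_{2n+2} + F_{2n+1}.
module Submission where

open import Defs
open import Data.Nat using (ℕ; zero; suc; _+_; _*_; _∸_; _<_; _≤_; z≤n; s≤s; _≟_; _≤?_; _<?_; _%_)
open import Data.Nat.DivMod using (m<n⇒m%n≡m; m%n<n; [m+n]%n≡m%n; %-distribˡ-+; m%n%n≡m%n; n%n≡0)
open import Data.Nat.Properties
open import Data.Nat.Solver using (module +-*-Solver)
open import Algebra.Properties.CommutativeSemigroup +-commutativeSemigroup using () renaming (interchange to +-interchange)
open import Data.Bool using (Bool; true; false; not; _∧_; if_then_else_)
open import Data.Vec using (Vec; []; _∷_; head; lookup)
open import Data.Fin using (Fin; zero; suc; inject₁; toℕ; fromℕ<)
import Data.Fin as Fin
open import Data.Fin.Properties using (toℕ-injective; toℕ-inject₁; toℕ<n; toℕ-fromℕ<)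
open import Data.List
  using (List; []; _∷_; _++_; length; take; drop; filter; concatMap; cartesianProduct; map; allFin; tabulate)
open import Data.Product using (∃-syntax; _×_; _,_; proj₁; proj₂)
open import Data.Sum using (_⊎_; inj₁; inj₂)
open import Data.Unit using (⊤; tt)
open import Data.Empty using (⊥; ⊥-elim)
open import Data.List.Relation.Unary.Any using (Any; here; there)
open import Data.List.Relation.Unary.Linked using (Linked; []; [-]; _∷_)
import Data.List.Relation.Unary.Linked as Linked
import Data.List.Relation.Unary.Linked.Properties as Linked
open import Data.Maybe.Relation.Binary.Connected using (Connected; just; nothing-just)
open import Data.Maybe using (Maybe; just; nothing)
open import Relation.Binary.PropositionalEquality
open import Relation.Nullary using (Dec; does; yes; no; ¬_)
open import Relation.Nullary.Decidable using (dec-true; dec-false)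
open import Function using (id; _∘′_; case_of_)
open import Data.List.Properties
  using (++-assoc; ++-identityʳ; map-++; concatMap-++; concatMap-map; map-tabulate; take-map; drop-map; take-take;
         drop-drop; take-drop; take-suc-tabulate; length-++; length-map; length-take; length-drop; length-tabulate)
import Data.List.Relation.Unary.Any.Properties as Any

private
  variable
    A B : Set

𝟙 : Bool → ℕ
𝟙 b = if b then 1 else 0

𝟙≤1 : ∀ b → 𝟙 b ≤ 1
𝟙≤1 true = ≤-refl
𝟙≤1 false = z≤n

sumOver : (A → ℕ) → List A → ℕ
sumOver f [] = 0
sumOver f (x ∷ xs) = f x + sumOver f xs

sumOver-++ : (f : A → ℕ) (xs ys : List A) → sumOver f (xs ++ ys) ≡ sumOver f xs + sumOver f ys
sumOver-++ f [] ys = refl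
sumOver-++ f (x ∷ xs) ys = trans (cong (f x +_) (sumOver-++ f xs ys)) (sym (+-assoc (f x) _ _))

sumOver-cong : {f g : A → ℕ} → (∀ x → f x ≡ g x) → (xs : List A) → sumOver f xs ≡ sumOver g xs
sumOver-cong f≗g [] = refl
sumOver-cong f≗g (x ∷ xs) = cong₂ _+_ (f≗g x) (sumOver-cong f≗g xs)

sumOver-+ : (f g : A → ℕ) (xs : List A) → sumOver (λ x → f x + g x) xs ≡ sumOver f xs + sumOver g xs
sumOver-+ f g [] = refl
sumOver-+ f g (x ∷ xs) = trans (cong (f x + g x +_) (sumOver-+ f g xs)) (+-interchange (f x) (g x) _ _)

sumOver-zero : (xs : List A) → sumOver (λ _ → 0) xs ≡ 0
sumOver-zero [] = refl
sumOver-zero (x ∷ xs) = sumOver-zero xs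

sumOver-concatMap : (f : B → ℕ) (g : A → List B) (xs : List A) →
                    sumOver f (concatMap g xs) ≡ sumOver (sumOver f ∘′ g) xs
sumOver-concatMap f g [] = refl
sumOver-concatMap f g (x ∷ xs) =
  trans (sumOver-++ f (g x) (concatMap g xs)) (cong (sumOver f (g x) +_) (sumOver-concatMap f g xs))

sumOver-map : (f : B → ℕ) (g : A → B) (xs : List A) → sumOver f (map g xs) ≡ sumOver (f ∘′ g) xs
sumOver-map f g [] = refl
sumOver-map f g (x ∷ xs) = cong (f (g x) +_) (sumOver-map f g xs)

sumOver-cartesianProduct : (f : A × B → ℕ) (xs : List A) (ys : List B) →
  sumOver f (cartesianProduct xs ys) ≡ sumOver (λ x → sumOver (λ y → f (x , y)) ys) xs
sumOver-cartesianProduct f [] ys = refl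
sumOver-cartesianProduct f (x ∷ xs) ys =
  trans (sumOver-++ f (map (x ,_) ys) _) (cong₂ _+_ (sumOver-map f (x ,_) ys) (sumOver-cartesianProduct f xs ys))

length-filter≡sumOver : {P : A → Set} (P? : ∀ x → Dec (P x)) (xs : List A) →
                        length (filter P? xs) ≡ sumOver (λ x → 𝟙 (does (P? x))) xs
length-filter≡sumOver P? [] = refl
length-filter≡sumOver P? (x ∷ xs) with does (P? x)
... | true = cong suc (length-filter≡sumOver P? xs)
... | false = length-filter≡sumOver P? xs

module _ (f : A → Bool) where

  sumOver-𝟙 : (xs : List A) → sumOver (λ x → 𝟙 (f x)) xs ≡ count f xs
  sumOver-𝟙 [] = refl
  sumOver-𝟙 (x ∷ xs) = cong (𝟙 (f x) +_) (sumOver-𝟙 xs)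

  count-++ : (xs ys : List A) → count f (xs ++ ys) ≡ count f xs + count f ys
  count-++ [] ys = refl
  count-++ (x ∷ xs) ys = trans (cong (𝟙 (f x) +_) (count-++ xs ys)) (sym (+-assoc (𝟙 (f x)) _ _))

  count-take≤ : ∀ k (xs : List A) → count f (take k xs) ≤ count f xs
  count-take≤ zero xs = z≤n
  count-take≤ (suc k) [] = z≤n
  count-take≤ (suc k) (x ∷ xs) = +-monoʳ-≤ (𝟙 (f x)) (count-take≤ k xs)

  count-drop≤ : ∀ k (xs : List A) → count f (drop k xs) ≤ count f xs
  count-drop≤ zero xs = ≤-refl
  count-drop≤ (suc k) [] = z≤n
  count-drop≤ (suc k) (x ∷ xs) = ≤-trans (count-drop≤ k xs) (m≤n+m _ (𝟙 (f x)))

count-framed : (f : A → Bool) (x : A) (M : List A) (y : A) →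
               count f (x ∷ (M ++ y ∷ [])) ≡ 𝟙 (f x) + (count f M + 𝟙 (f y))
count-framed f x M y = cong (𝟙 (f x) +_) (trans (count-++ f M (y ∷ [])) (cong (count f M +_) (+-identityʳ _)))

take-++ˡ : ∀ k (xs ys : List A) → k ≤ length xs → take k (xs ++ ys) ≡ take k xs
take-++ˡ zero xs ys _ = refl
take-++ˡ (suc k) (x ∷ xs) ys (s≤s k≤) = cong (x ∷_) (take-++ˡ k xs ys k≤)

drop-++ˡ : ∀ k (xs ys : List A) → k ≤ length xs → drop k (xs ++ ys) ≡ drop k xs ++ ys
drop-++ˡ zero xs ys _ = refl
drop-++ˡ (suc k) (x ∷ xs) ys (s≤s k≤) = drop-++ˡ k xs ys k≤

take-++-length : ∀ (xs ys : List A) m → take (length xs + m) (xs ++ ys) ≡ xs ++ take m ys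
take-++-length [] ys m = refl
take-++-length (x ∷ xs) ys m = cong (x ∷_) (take-++-length xs ys m)

drop-take : ∀ k L (xs : List A) → k ≤ L → drop k (take L xs) ≡ take (L ∸ k) (drop k xs)
drop-take k L xs k≤L = trans (cong (λ m → drop k (take m xs)) (sym (m+[n∸m]≡n k≤L))) (sym (take-drop (L ∸ k) k xs))

take-drop-periodic : ∀ (X : List A) r m → r + m ≤ length X →
                     take m (drop r (X ++ X)) ≡ take m (drop (length X + r) (X ++ X))
take-drop-periodic X r m r+m≤ = begin
    take m (drop r (X ++ X))
  ≡⟨ cong (take m) (drop-++ˡ r X X (m+n≤o⇒m≤o r r+m≤)) ⟩
    take m (drop r X ++ X)
  ≡⟨ take-++ˡ m (drop r X) X m≤ ⟩
    take m (drop r X)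
  ≡⟨ cong (λ xs → take m (drop r xs)) (sym (drop-length-++ X X)) ⟩
    take m (drop r (drop (length X) (X ++ X)))
  ≡⟨ cong (take m) (drop-drop (length X) r (X ++ X)) ⟩
    take m (drop (length X + r) (X ++ X))
  ∎
  where
  open ≡-Reasoning
  drop-length-++ : (xs ys : List A) → drop (length xs) (xs ++ ys) ≡ ys
  drop-length-++ [] ys = refl
  drop-length-++ (x ∷ xs) ys = drop-length-++ xs ys
  m≤ : m ≤ length (drop r X)
  m≤ = subst (m ≤_) (sym (length-drop r X)) (m+n≤o⇒m≤o∸n m (subst (_≤ length X) (+-comm r m) r+m≤))

Linked-take : ∀ {R : A → A → Set} k {xs} → Linked R xs → Linked R (take k xs)
Linked-take zero _ = []
Linked-take (suc k) [] = []
Linked-take (suc zero) [-] = [-]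
Linked-take (suc (suc k)) [-] = [-]
Linked-take (suc zero) (_ ∷ _) = [-]
Linked-take (suc (suc k)) (r ∷ rs) = r ∷ Linked-take (suc k) rs

Linked-drop : ∀ {R : A → A → Set} k {xs} → Linked R xs → Linked R (drop k xs)
Linked-drop zero rs = rs
Linked-drop (suc k) [] = []
Linked-drop (suc k) [-] = Linked-drop k []
Linked-drop (suc k) (_ ∷ rs) = Linked-drop k rs

-- Discrete intermediate value theorems: along the list, P + #p grows by at most one per
-- element while 2 (Q + #q) grows by zero or two, so their difference cannot jump over 0.
module _ (p q : A → Bool) where

  prefix-balance : ∀ xs {P Q} → P ≤ 2 * Q → 2 * (Q + count q xs) ≤ P + count p xs →
                   ∃[ k ] k ≤ length xs × P + count p (take k xs) ≡ 2 * (Q + count q (take k xs))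
  prefix-balance [] {P} {Q} atStart atEnd =
    0 , z≤n , ≤-antisym (subst₂ _≤_ (sym (+-identityʳ P)) (cong (2 *_) (sym (+-identityʳ Q))) atStart) atEnd
  prefix-balance (x ∷ xs) {P} {Q} atStart atEnd with P ≟ 2 * Q
  ... | yes P≡2Q = 0 , z≤n , trans (+-identityʳ P) (trans P≡2Q (cong (2 *_) (sym (+-identityʳ Q))))
  ... | no P≢2Q with prefix-balance xs {P + 𝟙 (p x)} {Q + 𝟙 (q x)} atStart′ atEnd′
    where
    atStart′ : P + 𝟙 (p x) ≤ 2 * (Q + 𝟙 (q x))
    atStart′ = begin
      P + 𝟙 (p x)       ≤⟨ +-monoʳ-≤ P (𝟙≤1 (p x)) ⟩
      P + 1             ≡⟨ +-comm P 1 ⟩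
      suc P             ≤⟨ ≤∧≢⇒< atStart P≢2Q ⟩
      2 * Q             ≤⟨ *-monoʳ-≤ 2 (m≤m+n Q _) ⟩
      2 * (Q + 𝟙 (q x)) ∎
      where open ≤-Reasoning
    atEnd′ : 2 * (Q + 𝟙 (q x) + count q xs) ≤ P + 𝟙 (p x) + count p xs
    atEnd′ = subst₂ (λ a b → 2 * a ≤ b) (sym (+-assoc Q _ _)) (sym (+-assoc P _ _)) atEnd
  ... | k , k≤ , balanced =
    suc k , s≤s k≤ , trans (sym (+-assoc P _ _)) (trans balanced (cong (2 *_) (+-assoc Q _ _)))

  suffix-balance : ∀ xs {P Q} → 2 * (Q + count q xs) ≤ P + count p xs → P ≤ 2 * Q →
                   ∃[ k ] k ≤ length xs × P + count p (drop k xs) ≡ 2 * (Q + count q (drop k xs))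
  suffix-balance [] {P} {Q} atStart atEnd =
    0 , z≤n , ≤-antisym (subst₂ _≤_ (sym (+-identityʳ P)) (cong (2 *_) (sym (+-identityʳ Q))) atEnd) atStart
  suffix-balance (x ∷ xs) {P} {Q} atStart atEnd with P + count p (x ∷ xs) ≟ 2 * (Q + count q (x ∷ xs))
  ... | yes balanced = 0 , z≤n , balanced
  ... | no unbalanced with suffix-balance xs {P} {Q} atStart′ atEnd
    where
    atStart′ : 2 * (Q + count q xs) ≤ P + count p xs
    atStart′ = m<1+n⇒m≤n (begin-strict
      2 * (Q + count q xs)                ≤⟨ *-monoʳ-≤ 2 (+-monoʳ-≤ Q (m≤n+m _ (𝟙 (q x)))) ⟩
      2 * (Q + count q (x ∷ xs))          <⟨ ≤∧≢⇒< atStart (unbalanced ∘′ sym) ⟩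
      P + (𝟙 (p x) + count p xs)          ≤⟨ +-monoʳ-≤ P (+-monoˡ-≤ _ (𝟙≤1 (p x))) ⟩
      P + suc (count p xs)                ≡⟨ +-suc P _ ⟩
      suc (P + count p xs)                ∎)
      where open ≤-Reasoning
  ... | k , k≤ , balanced = suc k , s≤s k≤ , balanced

-- Pairs without a clash

sumOver-allVecs : ∀ m (f : Vec Bool (suc m) → ℕ) →
                  sumOver f (allVecs (suc m)) ≡ sumOver (λ v → f (false ∷ v) + f (true ∷ v)) (allVecs m)
sumOver-allVecs m f =
  trans (sumOver-concatMap f _ (allVecs m)) (sumOver-cong (λ v → cong (f (false ∷ v) +_) (+-identityʳ _)) (allVecs m))

-- v_{j+1} ∈ S₂ forbids u_j ∈ S₁ and u_{j+1} ∈ S₁; `Clash` below states the same as a proposition.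
independent : ∀ {n} → Vec Bool (suc n) → Vec Bool n → Bool
independent {zero} (_ ∷ []) [] = true
independent {suc n} (_ ∷ S₁) (false ∷ S₂) = independent S₁ S₂
independent {suc n} (a ∷ S₁) (true ∷ S₂) = not a ∧ not (head S₁) ∧ independent S₁ S₂

numIndependent : ℕ → ℕ
numIndependent n = sumOver (λ S₁ → sumOver (λ S₂ → 𝟙 (independent S₁ S₂)) (allVecs n)) (allVecs (suc n))

numIndependentWithHead : ℕ → Bool → ℕ
numIndependentWithHead n a = sumOver (λ S₁ → sumOver (λ S₂ → 𝟙 (independent (a ∷ S₁) S₂)) (allVecs n)) (allVecs n)

numIndependent-split : ∀ n → numIndependent n ≡ numIndependentWithHead n false + numIndependentWithHead n true
numIndependent-split n = trans (sumOver-allVecs n _) (sumOver-+ _ _ (allVecs n))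

numIndependentWithHead-suc : ∀ n a →
  numIndependentWithHead (suc n) a ≡ numIndependent n + (if a then 0 else numIndependentWithHead n false)
numIndependentWithHead-suc n a = begin
    numIndependentWithHead (suc n) a
  ≡⟨ sumOver-cong (λ S₁ → sumOver-allVecs n (λ S₂ → 𝟙 (independent (a ∷ S₁) S₂))) (allVecs (suc n)) ⟩
    sumOver (λ S₁ → sumOver (λ S₂ → 𝟙 (independent S₁ S₂) + 𝟙 (independent (a ∷ S₁) (true ∷ S₂))) (allVecs n))
            (allVecs (suc n))
  ≡⟨ sumOver-cong (λ S₁ → sumOver-+ _ _ (allVecs n)) (allVecs (suc n)) ⟩
    sumOver (λ S₁ → sumOver (λ S₂ → 𝟙 (independent S₁ S₂)) (allVecs n)
                  + sumOver (λ S₂ → 𝟙 (independent (a ∷ S₁) (true ∷ S₂))) (allVecs n)) (allVecs (suc n))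
  ≡⟨ sumOver-+ _ _ (allVecs (suc n)) ⟩
    numIndependent n + sumOver (λ S₁ → sumOver (λ S₂ → 𝟙 (independent (a ∷ S₁) (true ∷ S₂))) (allVecs n))
                               (allVecs (suc n))
  ≡⟨ cong (numIndependent n +_) (v₁∈S₂ a) ⟩
    numIndependent n + (if a then 0 else numIndependentWithHead n false)
  ∎
  where
  open ≡-Reasoning
  v₁∈S₂ : ∀ a → sumOver (λ S₁ → sumOver (λ S₂ → 𝟙 (independent (a ∷ S₁) (true ∷ S₂))) (allVecs n))
                        (allVecs (suc n))
                ≡ (if a then 0 else numIndependentWithHead n false)
  v₁∈S₂ true =
    trans (sumOver-cong (λ S₁ → sumOver-zero (allVecs n)) (allVecs (suc n))) (sumOver-zero (allVecs (suc n)))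
  v₁∈S₂ false = trans (sumOver-allVecs n _) (sumOver-cong (λ S₁ →
    trans (cong (numIndependentFrom S₁ +_) (sumOver-zero (allVecs n))) (+-identityʳ _)) (allVecs n))
    where
    numIndependentFrom : Vec Bool n → ℕ
    numIndependentFrom S₁ = sumOver (λ S₂ → 𝟙 (independent (false ∷ S₁) S₂)) (allVecs n)

numIndependentWithHead≡fib : ∀ n → numIndependentWithHead n true ≡ fib (suc (2 * n))
                                 × numIndependentWithHead n false ≡ fib (suc (suc (2 * n)))
numIndependentWithHead≡fib zero = refl , refl
numIndependentWithHead≡fib (suc n) =
  trans (numIndependentWithHead-suc n true)
        (trans (+-identityʳ _) (trans numIndependent≡ (cong (λ m → fib (suc m)) (sym (*-suc 2 n))))) ,
  trans (numIndependentWithHead-suc n false)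
        (trans (cong₂ _+_ numIndependent≡ (proj₂ ih)) (cong (λ m → fib (suc (suc m))) (sym (*-suc 2 n))))
  where
  ih = numIndependentWithHead≡fib n
  numIndependent≡ : numIndependent n ≡ fib (3 + 2 * n)
  numIndependent≡ = trans (numIndependent-split n) (cong₂ _+_ (proj₂ ih) (proj₁ ih))

numIndependent≡fib : ∀ n → numIndependent n ≡ fib (2 * n + 3)
numIndependent≡fib n = trans (numIndependent-split n)
  (trans (cong₂ _+_ (proj₂ (numIndependentWithHead≡fib n)) (proj₁ (numIndependentWithHead≡fib n)))
         (cong fib (+-comm 3 (2 * n))))

fib-+4 : ∀ m → fib (4 + m) + fib m ≡ 3 * fib (2 + m)
fib-+4 m = identity (fib (suc m)) (fib m)
  where
  open +-*-Solver
  identity : ∀ a b → ((a + b) + a) + (a + b) + b ≡ 3 * (a + b)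
  identity = solve 2 (λ a b → ((a :+ b) :+ a) :+ (a :+ b) :+ b := con 3 :* (a :+ b)) refl

Clash : ∀ {n} → Vec Bool (suc n) → Vec Bool n → Set
Clash {n} S₁ S₂ = ∃[ j ] lookup S₂ j ≡ true × (lookup S₁ (suc j) ≡ true ⊎ lookup S₁ (inject₁ j) ≡ true)

independent-sound : ∀ {n} (S₁ : Vec Bool (suc n)) S₂ → independent S₁ S₂ ≡ true → ¬ Clash S₁ S₂
independent-sound {suc n} (a ∷ S₁) (false ∷ S₂) ind (suc j , v , u) = independent-sound S₁ S₂ ind (j , v , u)
independent-sound {suc n} (false ∷ false ∷ S₁) (true ∷ S₂) ind (suc j , v , u) =
  independent-sound (false ∷ S₁) S₂ ind (j , v , u)
independent-sound {suc n} (false ∷ false ∷ S₁) (true ∷ S₂) ind (zero , _ , inj₁ ())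
independent-sound {suc n} (false ∷ false ∷ S₁) (true ∷ S₂) ind (zero , _ , inj₂ ())
independent-sound {suc n} (false ∷ true ∷ S₁) (true ∷ S₂) ()
independent-sound {suc n} (true ∷ S₁) (true ∷ S₂) ()

Clash-∷ : ∀ {n} {S₁ : Vec Bool (suc n)} {S₂} a b → Clash S₁ S₂ → Clash (a ∷ S₁) (b ∷ S₂)
Clash-∷ a b (j , v , u) = suc j , v , u

independent-complete : ∀ {n} (S₁ : Vec Bool (suc n)) S₂ → independent S₁ S₂ ≡ false → Clash S₁ S₂
independent-complete {zero} (_ ∷ []) [] ()
independent-complete {suc n} (a ∷ S₁) (false ∷ S₂) ind = Clash-∷ a false (independent-complete S₁ S₂ ind)
independent-complete {suc n} (true ∷ S₁) (true ∷ S₂) _ = zero , refl , inj₂ refl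
independent-complete {suc n} (false ∷ true ∷ S₁) (true ∷ S₂) _ = zero , refl , inj₁ refl
independent-complete {suc n} (false ∷ false ∷ S₁) (true ∷ S₂) ind =
  Clash-∷ false true (independent-complete (false ∷ S₁) S₂ ind)

-- Steps of the path

step : ∀ {n} → Fin (suc n) → List (Edge n)
step zero = hor zero ∷ []
step (suc j) = hor (suc j) ∷ ver j ∷ []

walk : ∀ {n} → List (Fin (suc n)) → List (Edge n)
walk = concatMap step

isStep₀ : ∀ {n} → Fin (suc n) → Bool
isStep₀ zero = true
isStep₀ (suc _) = false

verticalIn : ∀ {n} → Vec Bool n → Fin (suc n) → Bool
verticalIn S₂ zero = false
verticalIn S₂ (suc j) = lookup S₂ j

module _ {n : ℕ} where

  count-isH-walk : (ts : List (Fin (suc n))) → count isH (walk ts) ≡ length ts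
  count-isH-walk [] = refl
  count-isH-walk (zero ∷ ts) = cong suc (count-isH-walk ts)
  count-isH-walk (suc j ∷ ts) = cong suc (count-isH-walk ts)

  count-isV-walk : (ts : List (Fin (suc n))) → count isV (walk ts) + count isStep₀ ts ≡ length ts
  count-isV-walk [] = refl
  count-isV-walk (zero ∷ ts) = trans (+-suc _ _) (cong suc (count-isV-walk ts))
  count-isV-walk (suc j ∷ ts) = cong suc (count-isV-walk ts)

  count-inS₁-walk : (S₁ : Vec Bool (suc n)) (ts : List (Fin (suc n))) →
                    count (inS₁ S₁) (walk ts) ≡ count (lookup S₁) ts
  count-inS₁-walk S₁ [] = refl
  count-inS₁-walk S₁ (zero ∷ ts) = cong (𝟙 (lookup S₁ zero) +_) (count-inS₁-walk S₁ ts)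
  count-inS₁-walk S₁ (suc j ∷ ts) = cong (𝟙 (lookup S₁ (suc j)) +_) (count-inS₁-walk S₁ ts)

  count-inS₂-walk : (S₂ : Vec Bool n) (ts : List (Fin (suc n))) →
                    count (inS₂ S₂) (walk ts) ≡ count (verticalIn S₂) ts
  count-inS₂-walk S₂ [] = refl
  count-inS₂-walk S₂ (zero ∷ ts) = count-inS₂-walk S₂ ts
  count-inS₂-walk S₂ (suc j ∷ ts) = cong (𝟙 (lookup S₂ j) +_) (count-inS₂-walk S₂ ts)

  -- Deliberately permissive at step 0, which has no vertical edge.
  StepAfter : Fin (suc n) → Fin (suc n) → Set
  StepAfter s zero = ⊤
  StepAfter s (suc j) = s ≡ inject₁ j

module _ {n : ℕ} (S₁ : Vec Bool (suc n)) (S₂ : Vec Bool n) (noClash : ¬ Clash S₁ S₂) where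

  marks : Fin (suc n) → ℕ
  marks s = 𝟙 (lookup S₁ s) + 𝟙 (verticalIn S₂ s)

  marks≤1 : ∀ s → marks s ≤ 1
  marks≤1 zero = subst (_≤ 1) (sym (+-identityʳ _)) (𝟙≤1 _)
  marks≤1 (suc j) with lookup S₁ (suc j) in u | lookup S₂ j in v
  ... | true | true = ⊥-elim (noClash (j , v , inj₁ u))
  ... | true | false = ≤-refl
  ... | false | b = 𝟙≤1 b

  sumOver-marks≤length : ∀ ts → sumOver marks ts ≤ length ts
  sumOver-marks≤length [] = z≤n
  sumOver-marks≤length (t ∷ ts) = +-mono-≤ (marks≤1 t) (sumOver-marks≤length ts)

  verticalIn-S₁ : ∀ s → lookup S₁ s ≡ true → verticalIn S₂ s ≡ false
  verticalIn-S₁ zero _ = refl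
  verticalIn-S₁ (suc t) u with lookup S₂ t in v
  ... | false = refl
  ... | true = ⊥-elim (noClash (t , v , inj₁ u))

  verticalIn-StepAfter : ∀ s t → lookup S₁ s ≡ true → StepAfter s t → verticalIn S₂ t ≡ false
  verticalIn-StepAfter s zero _ _ = refl
  verticalIn-StepAfter s (suc j) u refl with lookup S₂ j in v
  ... | false = refl
  ... | true = ⊥-elim (noClash (j , v , inj₂ u))

  -- Between a step carrying an edge of S₁ and a later one carrying an edge of S₂ there is an
  -- unmarked step, since no step carries both and a step after an S₁-step carries no S₂-edge.
  marks-before-vertical : ∀ s ts → Linked StepAfter (s ∷ ts) → verticalIn S₂ s ≡ false →
                          Any (λ t → verticalIn S₂ t ≡ true) ts → sumOver marks (s ∷ ts) ≤ length ts
  marks-before-vertical s ts linked v any with lookup S₁ s in u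
  marks-before-vertical s ts linked v any | false rewrite v = sumOver-marks≤length ts
  marks-before-vertical s (t ∷ ts) (after ∷ linked) v (here vt) | true
    with () ← trans (sym (verticalIn-StepAfter s t u after)) vt
  marks-before-vertical s (t ∷ ts) (after ∷ linked) v (there any) | true rewrite v =
    s≤s (marks-before-vertical t ts linked (verticalIn-StepAfter s t u after) any)

  sumOver-marks : ∀ ts → sumOver marks ts ≡ count (lookup S₁) ts + count (verticalIn S₂) ts
  sumOver-marks ts = trans (sumOver-+ (λ s → 𝟙 (lookup S₁ s)) (λ s → 𝟙 (verticalIn S₂ s)) ts)
    (cong₂ _+_ (sumOver-𝟙 (lookup S₁) ts) (sumOver-𝟙 (verticalIn S₂) ts))

-- The subpath from the left end of u_i to the upper end of v_{j+1}, as a run of steps.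
record Window {n : ℕ} (i : Fin (suc n)) (j : Fin n) : Set where
  field
    later : List (Fin (suc n))
    linked : Linked StepAfter (i ∷ later)
    ends-at : ∃[ init ] i ∷ later ≡ init ++ suc j ∷ []
    step₀-at-most-once : count isStep₀ (i ∷ later) ≤ 1
    subpath≡walk : subpath n (leftEnd i) (loopLen n (leftEnd i) (upperEnd j)) ≡ walk (i ∷ later)
    length-forward : toℕ i ≤ suc (toℕ j) → length (i ∷ later) + toℕ i ≡ 2 + toℕ j

walk-from-to : ∀ {n} (i : Fin (suc n)) (j : Fin n) later → (∃[ init ] i ∷ later ≡ init ++ suc j ∷ []) →
               ∃[ M ] walk (i ∷ later) ≡ hor i ∷ (M ++ ver j ∷ [])
walk-from-to i j later ([] , refl) = [] , refl
walk-from-to {n} i j _ (.i ∷ init , refl) = rest i ++ walk init ++ hor (suc j) ∷ [] , walk≡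
  where
  rest : Fin (suc n) → List (Edge n)
  rest zero = []
  rest (suc t) = ver t ∷ []
  step-∷ : ∀ s → step s ≡ hor s ∷ rest s
  step-∷ zero = refl
  step-∷ (suc t) = refl
  open ≡-Reasoning
  walk≡ : walk (i ∷ init ++ suc j ∷ []) ≡ hor i ∷ (rest i ++ walk init ++ hor (suc j) ∷ []) ++ ver j ∷ []
  walk≡ = begin
      step i ++ walk (init ++ suc j ∷ [])
    ≡⟨ cong (step i ++_) (concatMap-++ step init (suc j ∷ [])) ⟩
      step i ++ walk init ++ hor (suc j) ∷ ver j ∷ []
    ≡⟨ cong (_++ walk init ++ hor (suc j) ∷ ver j ∷ []) (step-∷ i) ⟩
      hor i ∷ rest i ++ walk init ++ (hor (suc j) ∷ []) ++ ver j ∷ []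
    ≡⟨ cong (λ xs → hor i ∷ rest i ++ xs) (sym (++-assoc (walk init) (hor (suc j) ∷ []) (ver j ∷ []))) ⟩
      hor i ∷ rest i ++ (walk init ++ hor (suc j) ∷ []) ++ ver j ∷ []
    ≡⟨ cong (hor i ∷_) (sym (++-assoc (rest i) (walk init ++ hor (suc j) ∷ []) (ver j ∷ []))) ⟩
      hor i ∷ (rest i ++ walk init ++ hor (suc j) ∷ []) ++ ver j ∷ []
    ∎

BalancedAt : ∀ {n} → Vec Bool (suc n) → Vec Bool n → List (Edge n) → ℕ → Set
BalancedAt S₁ S₂ W k = count isH (drop k W) ≡ 2 * count (inS₂ S₂) (drop k W)
                     ⊎ count isV (take k W) ≡ 2 * count (inS₁ S₁) (take k W)

too-many-marks : ∀ {h v z a b c} → h + 1 ≡ c → v + 1 + z ≡ c → z ≤ 1 →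
                 v < 2 * (1 + a) → h < 2 * (1 + b) → a + b + 3 ≤ c → ⊥
too-many-marks {h} {v} {z} {a} {b} {c} hc vc z≤1 v< h< marks = <-irrefl refl (begin-strict
  2 * (a + b + 3)              ≤⟨ *-monoʳ-≤ 2 marks ⟩
  2 * c                        ≡⟨ cong (c +_) (+-identityʳ c) ⟩
  c + c                        ≡⟨ cong₂ _+_ (sym hc) (sym vc) ⟩
  (h + 1) + (v + 1 + z)        ≤⟨ +-monoʳ-≤ (h + 1) (+-monoʳ-≤ (v + 1) z≤1) ⟩
  (h + 1) + (v + 1 + 1)        ≡⟨ cong₂ _+_ (+-comm h 1) (+-comm (v + 1) 1) ⟩
  suc h + suc (v + 1)          ≤⟨ +-mono-≤ h< (s≤s (subst (_≤ 2 * (1 + a)) (+-comm 1 v) v<)) ⟩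
  2 * (1 + b) + suc (2 * (1 + a)) <⟨ ≤-reflexive (identity a b) ⟩
  2 * (a + b + 3)              ∎)
  where
  open ≤-Reasoning
  open +-*-Solver
  identity : ∀ a b → suc (2 * (1 + b) + suc (2 * (1 + a))) ≡ 2 * (a + b + 3)
  identity = solve 2 (λ a b → con 1 :+ (con 2 :* (con 1 :+ b) :+ (con 1 :+ con 2 :* (con 1 :+ a)))
                              := con 2 :* (a :+ b :+ con 3)) refl

module _ {n : ℕ} {i : Fin (suc n)} {j : Fin n} (later : List (Fin (suc n))) (M : List (Edge n))
         (walk≡ : walk (i ∷ later) ≡ hor i ∷ (M ++ ver j ∷ [])) where

  count-walk : (f : Edge n → Bool) → count f (walk (i ∷ later)) ≡ 𝟙 (f (hor i)) + (count f M + 𝟙 (f (ver j)))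
  count-walk f = trans (cong (count f) walk≡) (count-framed f (hor i) M (ver j))

  horizontal-count : count isH M + 1 ≡ length (i ∷ later)
  horizontal-count = begin
    count isH M + 1                  ≡⟨ +-comm _ 1 ⟩
    suc (count isH M)                ≡⟨ cong suc (sym (+-identityʳ _)) ⟩
    1 + (count isH M + 0)            ≡⟨ sym (count-walk isH) ⟩
    count isH (walk (i ∷ later))     ≡⟨ count-isH-walk (i ∷ later) ⟩
    length (i ∷ later)               ∎
    where open ≡-Reasoning

  vertical-count : count isV M + 1 + count isStep₀ (i ∷ later) ≡ length (i ∷ later)
  vertical-count = trans (cong (_+ count isStep₀ (i ∷ later)) (sym (count-walk isV))) (count-isV-walk (i ∷ later))

module _ {n : ℕ} (S₁ : Vec Bool (suc n)) (S₂ : Vec Bool n) (noClash : ¬ Clash S₁ S₂)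
         {i : Fin (suc n)} {j : Fin n} (window : Window i j)
         (u∈S₁ : lookup S₁ i ≡ true) (v∈S₂ : lookup S₂ j ≡ true)
         (M : List (Edge n)) (walk≡ : walk (i ∷ Window.later window) ≡ hor i ∷ (M ++ ver j ∷ [])) where

  open Window window

  private
    W : List (Edge n)
    W = hor i ∷ (M ++ ver j ∷ [])

    steps : List (Fin (suc n))
    steps = i ∷ later

    some-later-vertical : Any (λ t → verticalIn S₂ t ≡ true) later
    some-later-vertical with ends-at
    ... | init , steps≡ with subst (Any (λ t → verticalIn S₂ t ≡ true)) (sym steps≡) (Any.++⁺ʳ init (here v∈S₂))
    ...   | here first = ⊥-elim (case trans (sym first) (verticalIn-S₁ S₁ S₂ noClash i u∈S₁) of λ ())
    ...   | there any = any

    mark-count : count (inS₁ S₁) M + count (inS₂ S₂) M + 3 ≤ length steps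
    mark-count = begin
      a + b + 3                                        ≡⟨ identity a b ⟩
      suc ((1 + (a + 0)) + (b + 1))                    ≡⟨ cong suc (cong₂ _+_ (cong (λ x → 𝟙 x + (a + 0)) (sym u∈S₁))
                                                                            (cong (λ x → b + 𝟙 x) (sym v∈S₂))) ⟩
      suc (𝟙 (lookup S₁ i) + (a + 0) + (b + 𝟙 (lookup S₂ j)))
        ≡⟨ cong suc (sym (cong₂ _+_ (count-walk later M walk≡ (inS₁ S₁)) (count-walk later M walk≡ (inS₂ S₂)))) ⟩
      suc (count (inS₁ S₁) (walk steps) + count (inS₂ S₂) (walk steps))
        ≡⟨ cong suc (cong₂ _+_ (count-inS₁-walk S₁ steps) (count-inS₂-walk S₂ steps)) ⟩
      suc (count (lookup S₁) steps + count (verticalIn S₂) steps)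
        ≡⟨ cong suc (sym (sumOver-marks S₁ S₂ noClash steps)) ⟩
      suc (sumOver (marks S₁ S₂ noClash) steps)
        ≤⟨ s≤s (marks-before-vertical S₁ S₂ noClash i later linked (verticalIn-S₁ S₁ S₂ noClash i u∈S₁)
                                      some-later-vertical) ⟩
      length steps                                     ∎
      where
      open ≤-Reasoning
      a = count (inS₁ S₁) M
      b = count (inS₂ S₂) M
      identity : ∀ a b → a + b + 3 ≡ suc ((1 + (a + 0)) + (b + 1))
      identity = solve 2 (λ a b → a :+ b :+ con 3 := con 1 :+ ((con 1 :+ (a :+ con 0)) :+ (b :+ con 1))) refl
        where open +-*-Solver

  balanced-in-window : ∃[ k ] k ≤ length M × BalancedAt S₁ S₂ (hor i ∷ (M ++ ver j ∷ [])) (suc k)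
  balanced-in-window with 2 * (1 + count (inS₁ S₁) M) ≤? count isV M
  ... | yes vertical-heavy =
    let k , k≤ , balanced = prefix-balance isV (inS₁ S₁) M {0} {1} z≤n vertical-heavy
    in  k , k≤ , inj₂ (begin
      count isV (take (suc k) W)                   ≡⟨ cong (count isV ∘′ (hor i ∷_)) (take-++ˡ k M _ k≤) ⟩
      count isV (take k M)                         ≡⟨ balanced ⟩
      2 * (1 + count (inS₁ S₁) (take k M))         ≡⟨ cong (λ x → 2 * (𝟙 x + count (inS₁ S₁) (take k M))) (sym u∈S₁) ⟩
      2 * count (inS₁ S₁) (hor i ∷ take k M)       ≡⟨ cong (λ xs → 2 * count (inS₁ S₁) (hor i ∷ xs)) (sym (take-++ˡ k M _ k≤)) ⟩
      2 * count (inS₁ S₁) (take (suc k) W)         ∎)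
    where open ≡-Reasoning
  ... | no vertical-light with 2 * (1 + count (inS₂ S₂) M) ≤? count isH M
  ...   | yes horizontal-heavy =
    let k , k≤ , balanced = suffix-balance isH (inS₂ S₂) M {0} {1} horizontal-heavy z≤n
    in  k , k≤ , inj₁ (begin
      count isH (drop (suc k) W)                   ≡⟨ cong (count isH) (drop-++ˡ k M _ k≤) ⟩
      count isH (drop k M ++ ver j ∷ [])           ≡⟨ count-++ isH (drop k M) _ ⟩
      count isH (drop k M) + 0                     ≡⟨ +-identityʳ _ ⟩
      count isH (drop k M)                         ≡⟨ balanced ⟩
      2 * (1 + count (inS₂ S₂) (drop k M))         ≡⟨ cong (2 *_) (+-comm 1 _) ⟩
      2 * (count (inS₂ S₂) (drop k M) + 1)         ≡⟨ cong (λ x → 2 * (count (inS₂ S₂) (drop k M) + (𝟙 x + 0))) (sym v∈S₂) ⟩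
      2 * (count (inS₂ S₂) (drop k M) + count (inS₂ S₂) (ver j ∷ []))
                                                   ≡⟨ cong (2 *_) (sym (count-++ (inS₂ S₂) (drop k M) _)) ⟩
      2 * count (inS₂ S₂) (drop k M ++ ver j ∷ []) ≡⟨ cong (λ xs → 2 * count (inS₂ S₂) xs) (sym (drop-++ˡ k M _ k≤)) ⟩
      2 * count (inS₂ S₂) (drop (suc k) W)         ∎)
    where open ≡-Reasoning
  ...   | no horizontal-light = ⊥-elim (too-many-marks (horizontal-count later M walk≡) (vertical-count later M walk≡)
                                                       step₀-at-most-once
                                                       (≰⇒> vertical-light) (≰⇒> horizontal-light) mark-count)

module _ {n : ℕ} (S₁ : Vec Bool (suc n)) (S₂ : Vec Bool n) {i : Fin (suc n)} {j : Fin n}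
         (u∈S₁ : lookup S₁ i ≡ true) (v∈S₂ : lookup S₂ j ≡ true) (M : List (Edge n)) where

  no-balance-in-short-window : count isV M ≤ 1 → count isH M ≤ 1 →
    ∀ k → k ≤ length M → ¬ BalancedAt S₁ S₂ (hor i ∷ (M ++ ver j ∷ [])) (suc k)
  no-balance-in-short-window V≤1 H≤1 k k≤ (inj₂ balanced)
    rewrite take-++ˡ k M (ver j ∷ []) k≤ | u∈S₁ = 1+n≰n (begin
      2                                       ≤⟨ *-monoʳ-≤ 2 (s≤s z≤n) ⟩
      2 * (1 + count (inS₁ S₁) (take k M))    ≡⟨ sym balanced ⟩
      count isV (take k M)                    ≤⟨ count-take≤ isV k M ⟩
      count isV M                             ≤⟨ V≤1 ⟩
      1                                       ∎)
    where open ≤-Reasoning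
  no-balance-in-short-window V≤1 H≤1 k k≤ (inj₁ balanced)
    rewrite drop-++ˡ k M (ver j ∷ []) k≤ | count-++ isH (drop k M) (ver j ∷ [])
          | count-++ (inS₂ S₂) (drop k M) (ver j ∷ []) | v∈S₂ = 1+n≰n (begin
      2                                       ≤⟨ *-monoʳ-≤ 2 (m≤n+m 1 (count (inS₂ S₂) (drop k M))) ⟩
      2 * (count (inS₂ S₂) (drop k M) + 1)    ≡⟨ sym balanced ⟩
      count isH (drop k M) + 0                ≡⟨ +-identityʳ _ ⟩
      count isH (drop k M)                    ≤⟨ count-drop≤ isH k M ⟩
      count isH M                             ≤⟨ H≤1 ⟩
      1                                       ∎)
    where open ≤-Reasoning

-- Subpaths of the closed path

pathTwice : ∀ n → List (Edge n)
pathTwice n = pathEdges n ++ pathEdges n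

pathEdges≡ : ∀ n → pathEdges n ≡ hor zero ∷ walk (map suc (allFin n))
pathEdges≡ n = cong (hor zero ∷_) (sym (concatMap-map step suc (allFin n)))

length-walk-suc : ∀ {n} (ts : List (Fin n)) → length (walk (map suc ts)) ≡ 2 * length ts
length-walk-suc [] = refl
length-walk-suc (t ∷ ts) = trans (cong (suc ∘′ suc) (length-walk-suc ts)) (sym (*-suc 2 (length ts)))

length-allFin : ∀ n → length (allFin n) ≡ n
length-allFin n = length-tabulate id

length-pathEdges : ∀ n → length (pathEdges n) ≡ N n
length-pathEdges n = trans (cong length (pathEdges≡ n))
  (cong suc (trans (length-walk-suc (allFin n)) (cong (2 *_) (length-allFin n))))

loopLen≤N : ∀ n p q → loopLen n p q ≤ N n
loopLen≤N n p q with (q + N n ∸ p) % N n in eq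
... | zero = ≤-refl
... | suc d = <⇒≤ (subst (_< N n) eq (m%n<n (q + N n ∸ p) (N n)))

loopLen-≡ : ∀ n p q L → 0 < L → L ≤ N n → (q + N n ∸ p) % N n ≡ L % N n → loopLen n p q ≡ L
loopLen-≡ n p q L 0<L L≤N eq with (q + N n ∸ p) % N n | L <? N n
... | zero  | yes L<N = ⊥-elim (<-irrefl (trans eq (m<n⇒m%n≡m L<N)) 0<L)
... | zero  | no L≮N = sym (≤-antisym L≤N (≮⇒≥ L≮N))
... | suc d | yes L<N = trans eq (m<n⇒m%n≡m L<N)
... | suc d | no L≮N with () ← trans eq (trans (cong (_% N n) (≤-antisym L≤N (≮⇒≥ L≮N))) (n%n≡0 (N n)))

loopLen-upperEnd : ∀ n (j : Fin n) E → E ≤ N n →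
                   (upperEnd j + N n ∸ E) % N n ≡ (3 + 2 * toℕ j + (N n ∸ E)) % N n
loopLen-upperEnd n j E E≤N = begin
    (a % N n + N n ∸ E) % N n
  ≡⟨ cong (_% N n) (+-∸-assoc (a % N n) E≤N) ⟩
    (a % N n + (N n ∸ E)) % N n
  ≡⟨ %-distribˡ-+ (a % N n) (N n ∸ E) (N n) ⟩
    (a % N n % N n + (N n ∸ E) % N n) % N n
  ≡⟨ cong (λ x → (x + (N n ∸ E) % N n) % N n) (m%n%n≡m%n a (N n)) ⟩
    (a % N n + (N n ∸ E) % N n) % N n
  ≡⟨ sym (%-distribˡ-+ a (N n ∸ E) (N n)) ⟩
    (a + (N n ∸ E)) % N n
  ∎
  where
  open ≡-Reasoning
  a = 3 + 2 * toℕ j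

leftEnd<N : ∀ {n} (i : Fin (suc n)) → leftEnd i < N n
leftEnd<N zero = s≤s z≤n
leftEnd<N (suc t) = s≤s (*-monoʳ-< 2 (toℕ<n t))

module _ (n : ℕ) {E L : ℕ} (E<N : E < N n) (L≤N : L ≤ N n) where

  length-subpath : length (subpath n E L) ≡ L
  length-subpath = trans (length-take L (drop E (pathTwice n))) (m≤n⇒m⊓n≡m (subst (L ≤_) (sym length-drop-pathTwice) L≤))
    where
    length-drop-pathTwice : length (drop E (pathTwice n)) ≡ N n + N n ∸ E
    length-drop-pathTwice = trans (length-drop E (pathTwice n))
      (cong (_∸ E) (trans (length-++ (pathEdges n)) (cong₂ _+_ (length-pathEdges n) (length-pathEdges n))))
    L≤ : L ≤ N n + N n ∸ E
    L≤ = m+n≤o⇒m≤o∸n L (≤-trans (+-monoʳ-≤ L (<⇒≤ E<N)) (+-monoˡ-≤ (N n) L≤N))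

  subpath-prefix : ∀ k → k ≤ L → subpath n E k ≡ take k (subpath n E L)
  subpath-prefix k k≤L = sym (trans (take-take k L _) (cong (λ m → take m (drop E (pathTwice n))) (m≤n⇒m⊓n≡m k≤L)))

  -- Past the end of the first lap the point (E + k) % N n is E + k - N n, and the second lap
  -- of pathTwice repeats the first.
  subpath-suffix : ∀ k → k ≤ L → subpath n ((E + k) % N n) (L ∸ k) ≡ drop k (subpath n E L)
  subpath-suffix k k≤L = trans (from-point (E + k <? N n)) (sym dropped)
    where
    dropped : drop k (subpath n E L) ≡ take (L ∸ k) (drop (E + k) (pathTwice n))
    dropped = trans (drop-take k L (drop E (pathTwice n)) k≤L) (cong (take (L ∸ k)) (drop-drop E k (pathTwice n)))
    from-point : Dec (E + k < N n) → subpath n ((E + k) % N n) (L ∸ k) ≡ take (L ∸ k) (drop (E + k) (pathTwice n))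
    from-point (yes E+k<N) = cong (λ p → take (L ∸ k) (drop p (pathTwice n))) (m<n⇒m%n≡m E+k<N)
    from-point (no E+k≮N) = begin
        take (L ∸ k) (drop ((E + k) % N n) (pathTwice n))
      ≡⟨ cong (λ p → take (L ∸ k) (drop p (pathTwice n))) wrapped ⟩
        take (L ∸ k) (drop r (pathTwice n))
      ≡⟨ take-drop-periodic (pathEdges n) r (L ∸ k) (subst (r + (L ∸ k) ≤_) (sym (length-pathEdges n)) r+L∸k≤N) ⟩
        take (L ∸ k) (drop (length (pathEdges n) + r) (pathTwice n))
      ≡⟨ cong (λ p → take (L ∸ k) (drop (p + r) (pathTwice n))) (length-pathEdges n) ⟩
        take (L ∸ k) (drop (N n + r) (pathTwice n))
      ≡⟨ cong (λ p → take (L ∸ k) (drop p (pathTwice n))) N+r≡E+k ⟩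
        take (L ∸ k) (drop (E + k) (pathTwice n))
      ∎
      where
      open ≡-Reasoning
      r = E + k ∸ N n
      N+r≡E+k : N n + r ≡ E + k
      N+r≡E+k = m+[n∸m]≡n (≮⇒≥ E+k≮N)
      r+L∸k≤N : r + (L ∸ k) ≤ N n
      r+L∸k≤N = +-cancelˡ-≤ (N n) _ _ (subst (_≤ N n + N n) (sym N+r+L∸k≡E+L) (+-mono-≤ (<⇒≤ E<N) L≤N))
        where
        N+r+L∸k≡E+L : N n + (r + (L ∸ k)) ≡ E + L
        N+r+L∸k≡E+L = begin
          N n + (r + (L ∸ k))      ≡⟨ sym (+-assoc (N n) r (L ∸ k)) ⟩
          N n + r + (L ∸ k)        ≡⟨ cong (_+ (L ∸ k)) N+r≡E+k ⟩
          E + k + (L ∸ k)          ≡⟨ +-assoc E k (L ∸ k) ⟩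
          E + (k + (L ∸ k))        ≡⟨ cong (E +_) (m+[n∸m]≡n k≤L) ⟩
          E + L                    ∎
      r<N : r < N n
      r<N = +-cancelˡ-< (N n) r (N n) (subst (_< N n + N n) (sym N+r≡E+k) (+-mono-<-≤ E<N (≤-trans k≤L L≤N)))
      wrapped : (E + k) % N n ≡ r
      wrapped = trans (cong (_% N n) (trans (sym N+r≡E+k) (+-comm (N n) r)))
                      (trans ([m+n]%n≡m%n r (N n)) (m<n⇒m%n≡m r<N))

-- Subpaths as runs of steps

Consecutive : ∀ {m} → Fin m → Fin m → Set
Consecutive s t = toℕ t ≡ suc (toℕ s)

allFin-suc : ∀ m → allFin (suc m) ≡ zero ∷ map suc (allFin m)
allFin-suc m = cong (zero ∷_) (sym (map-tabulate id suc))

Linked-map-suc : ∀ {m} {ts : List (Fin m)} → Linked Consecutive ts → Linked Consecutive (map suc ts)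
Linked-map-suc = Linked.map⁺ ∘′ Linked.map (cong suc)

allFin-consecutive : ∀ m → Linked Consecutive (allFin m)
allFin-consecutive zero = []
allFin-consecutive (suc zero) = [-]
allFin-consecutive (suc (suc m)) =
  subst (λ ts → Linked Consecutive (zero ∷ ts)) (map-tabulate id suc) (refl ∷ Linked-map-suc (allFin-consecutive (suc m)))

Consecutive⇒StepAfter : ∀ {n} {s t : Fin (suc n)} → Consecutive s t → StepAfter s t
Consecutive⇒StepAfter {t = zero} _ = tt
Consecutive⇒StepAfter {t = suc j} t≡1+s = toℕ-injective (trans (sym (suc-injective t≡1+s)) (sym (toℕ-inject₁ j)))

connected-to-step₀ : ∀ {n} (s : Maybe (Fin (suc n))) → Connected StepAfter s (just zero)
connected-to-step₀ (just s) = just tt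
connected-to-step₀ nothing = nothing-just

count-isStep₀-map-suc : ∀ {n} (ts : List (Fin n)) → count isStep₀ (map suc ts) ≡ 0
count-isStep₀-map-suc [] = refl
count-isStep₀-map-suc (t ∷ ts) = count-isStep₀-map-suc ts

drop-allFin : ∀ {m} (t : Fin m) → drop (toℕ t) (allFin m) ≡ t ∷ drop (suc (toℕ t)) (allFin m)
drop-allFin zero = refl
drop-allFin {suc m} (suc t) = begin
    drop (toℕ t) (tabulate suc)
  ≡⟨ cong (drop (toℕ t)) (sym (map-tabulate id suc)) ⟩
    drop (toℕ t) (map suc (allFin m))
  ≡⟨ drop-map (toℕ t) (allFin m) ⟩
    map suc (drop (toℕ t) (allFin m))
  ≡⟨ cong (map suc) (drop-allFin t) ⟩
    suc t ∷ map suc (drop (suc (toℕ t)) (allFin m))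
  ≡⟨ cong (suc t ∷_) (sym (drop-map (suc (toℕ t)) (allFin m))) ⟩
    suc t ∷ drop (suc (toℕ t)) (map suc (allFin m))
  ≡⟨ cong (λ ts → suc t ∷ drop (suc (toℕ t)) ts) (map-tabulate id suc) ⟩
    suc t ∷ drop (suc (toℕ t)) (tabulate suc)
  ∎
  where open ≡-Reasoning

map-suc-take-allFin : ∀ {n} (j : Fin n) →
  map suc (take (suc (toℕ j)) (allFin n)) ≡ map suc (take (toℕ j) (allFin n)) ++ suc j ∷ []
map-suc-take-allFin j = trans (cong (map suc) (take-suc-tabulate id j)) (map-++ suc (take (toℕ j) _) (j ∷ []))

take-walk-suc : ∀ {n} s (ts : List (Fin n)) ys → s ≤ length ts →
                take (2 * s) (walk (map suc ts) ++ ys) ≡ walk (map suc (take s ts))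
take-walk-suc zero ts ys _ = refl
take-walk-suc (suc s) (t ∷ ts) ys (s≤s s≤) rewrite +-suc s (s + 0) =
  cong (λ es → hor (suc t) ∷ ver t ∷ es) (take-walk-suc s ts ys s≤)

drop-walk-suc : ∀ {n} s (ts : List (Fin n)) ys → s ≤ length ts →
                drop (2 * s) (walk (map suc ts) ++ ys) ≡ walk (map suc (drop s ts)) ++ ys
drop-walk-suc zero ts ys _ = refl
drop-walk-suc (suc s) (t ∷ ts) ys (s≤s s≤) rewrite +-suc s (s + 0) = drop-walk-suc s ts ys s≤

module _ {n : ℕ} where

  stepsUpTo : Fin n → List (Fin (suc n))
  stepsUpTo j = zero ∷ map suc (take (suc (toℕ j)) (allFin n))

  stepsFrom : Fin n → List (Fin (suc n))
  stepsFrom t = map suc (drop (toℕ t) (allFin n))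

  private
    toℕ<length : ∀ (j : Fin n) → suc (toℕ j) ≤ length (allFin n)
    toℕ<length j = subst (suc (toℕ j) ≤_) (sym (length-allFin n)) (toℕ<n j)

    StepAfter-map-suc : ∀ {ts : List (Fin n)} → Linked Consecutive ts → Linked StepAfter (map suc ts)
    StepAfter-map-suc ts = Linked.map Consecutive⇒StepAfter (Linked-map-suc ts)

  stepsUpTo-linked : ∀ j → Linked StepAfter (stepsUpTo j)
  stepsUpTo-linked j = Linked.map Consecutive⇒StepAfter
    (subst (λ ts → Linked Consecutive (zero ∷ ts)) (take-map (suc (toℕ j)) (allFin n))
      (Linked-take (suc (suc (toℕ j))) (subst (Linked Consecutive) (allFin-suc n) (allFin-consecutive (suc n)))))

  stepsUpTo-ends : ∀ j → stepsUpTo j ≡ (zero ∷ map suc (take (toℕ j) (allFin n))) ++ suc j ∷ []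
  stepsUpTo-ends j = cong (zero ∷_) (map-suc-take-allFin j)

  count-isStep₀-stepsUpTo : ∀ j → count isStep₀ (stepsUpTo j) ≡ 1
  count-isStep₀-stepsUpTo j = cong suc (count-isStep₀-map-suc (take (suc (toℕ j)) (allFin n)))

  length-stepsUpTo : ∀ j → length (stepsUpTo j) ≡ 2 + toℕ j
  length-stepsUpTo j = cong suc (trans (length-map Fin.suc (take (suc (toℕ j)) (allFin n)))
    (trans (length-take (suc (toℕ j)) (allFin n)) (m≤n⇒m⊓n≡m (toℕ<length j))))

  take-pathEdges : ∀ j ys → take (3 + 2 * toℕ j) (pathEdges n ++ ys) ≡ walk (stepsUpTo j)
  take-pathEdges j ys = begin
      take (3 + 2 * toℕ j) (pathEdges n ++ ys)
    ≡⟨ cong (λ ps → take (3 + 2 * toℕ j) (ps ++ ys)) (pathEdges≡ n) ⟩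
      hor zero ∷ take (2 + 2 * toℕ j) (walk (map suc (allFin n)) ++ ys)
    ≡⟨ cong (λ m → hor zero ∷ take m (walk (map suc (allFin n)) ++ ys)) (sym (*-suc 2 (toℕ j))) ⟩
      hor zero ∷ take (2 * suc (toℕ j)) (walk (map suc (allFin n)) ++ ys)
    ≡⟨ cong (hor zero ∷_) (take-walk-suc (suc (toℕ j)) (allFin n) ys (toℕ<length j)) ⟩
      walk (stepsUpTo j)
    ∎
    where open ≡-Reasoning

  stepsFrom-linked : ∀ t → Linked StepAfter (stepsFrom t)
  stepsFrom-linked t = StepAfter-map-suc (Linked-drop (toℕ t) (allFin-consecutive n))

  stepsFrom-starts : ∀ t → stepsFrom t ≡ suc t ∷ map suc (drop (suc (toℕ t)) (allFin n))
  stepsFrom-starts t = cong (map suc) (drop-allFin t)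

  length-drop-allFin : ∀ t → length (drop t (allFin n)) ≡ n ∸ t
  length-drop-allFin t = trans (length-drop t (allFin n)) (cong (_∸ t) (length-allFin n))

  drop-pathEdges : ∀ t ys → drop (leftEnd (suc t)) (pathEdges n ++ ys) ≡ walk (stepsFrom t) ++ ys
  drop-pathEdges t ys = trans (cong (λ ps → drop (leftEnd (suc t)) (ps ++ ys)) (pathEdges≡ n))
    (drop-walk-suc (toℕ t) (allFin n) ys (<⇒≤ (subst (toℕ t <_) (sym (length-allFin n)) (toℕ<n t))))

  N∸leftEnd : ∀ (t : Fin n) → N n ∸ leftEnd (suc t) ≡ 2 * (n ∸ toℕ t)
  N∸leftEnd t = sym (*-distribˡ-∸ 2 n (toℕ t))

  private
    window-from : ∀ {i j} steps later → steps ≡ i ∷ later → Linked StepAfter steps →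
      (∃[ init ] steps ≡ init ++ suc j ∷ []) → count isStep₀ steps ≤ 1 →
      subpath n (leftEnd i) (loopLen n (leftEnd i) (upperEnd j)) ≡ walk steps →
      (toℕ i ≤ suc (toℕ j) → length steps + toℕ i ≡ 2 + toℕ j) → Window i j
    window-from _ later refl linked ends-at once subpath≡ length≡ = record
      { later = later ; linked = linked ; ends-at = ends-at ; step₀-at-most-once = once
      ; subpath≡walk = subpath≡ ; length-forward = length≡ }

  origin-window : ∀ j → Window zero j
  origin-window j = window-from (stepsUpTo j) _ refl (stepsUpTo-linked j)
    (zero ∷ map suc (take (toℕ j) (allFin n)) , stepsUpTo-ends j)
    (≤-reflexive (count-isStep₀-stepsUpTo j))
    (trans (cong (subpath n 0) loopLen≡) (take-pathEdges j (pathEdges n)))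
    (λ _ → trans (+-identityʳ _) (length-stepsUpTo j))
    where
    L≤N : 3 + 2 * toℕ j ≤ N n
    L≤N = s≤s (subst (_≤ 2 * n) (*-suc 2 (toℕ j)) (*-monoʳ-≤ 2 (toℕ<n j)))
    loopLen≡ : loopLen n 0 (upperEnd j) ≡ 3 + 2 * toℕ j
    loopLen≡ = loopLen-≡ n 0 (upperEnd j) _ (s≤s z≤n) L≤N
      (trans (loopLen-upperEnd n j 0 z≤n) ([m+n]%n≡m%n (3 + 2 * toℕ j) (N n)))

  forward-window : ∀ t j d → toℕ t + d ≡ toℕ j → Window (suc t) j
  forward-window t j d t+d≡j = window-from (take (suc d) (stepsFrom t)) _
    (cong (take (suc d)) (stepsFrom-starts t)) (Linked-take (suc d) (stepsFrom-linked t))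
    (map suc (drop (toℕ t) (take (toℕ j) (allFin n))) , ends)
    (subst (_≤ 1) (sym (trans (cong (count isStep₀) (take-map (suc d) (drop (toℕ t) (allFin n))))
                               (count-isStep₀-map-suc (take (suc d) (drop (toℕ t) (allFin n)))))) z≤n)
    (trans (cong (subpath n E) loopLen≡) subpath≡)
    (λ _ → trans (cong (_+ suc (toℕ t)) length≡) (trans (+-suc (suc d) (toℕ t))
             (cong (suc ∘′ suc) (trans (+-comm d (toℕ t)) t+d≡j))))
    where
    E = leftEnd (suc t)
    F = allFin n
    E≤N : E ≤ N n
    E≤N = <⇒≤ (leftEnd<N (suc t))
    d≤j : d ≤ toℕ j
    d≤j = subst (d ≤_) t+d≡j (m≤n+m d (toℕ t))
    1+d≤ : suc d ≤ length (drop (toℕ t) F)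
    1+d≤ = subst (suc d ≤_) (sym (length-drop-allFin (toℕ t)))
      (m+n≤o⇒m≤o∸n (suc d) (subst (_≤ n) (cong suc (trans (sym t+d≡j) (+-comm (toℕ t) d))) (toℕ<n j)))
    L≤N : 2 * suc d ≤ N n
    L≤N = ≤-trans (*-monoʳ-≤ 2 (≤-trans (s≤s d≤j) (toℕ<n j))) (n≤1+n (2 * n))
    offset : 3 + 2 * toℕ j + (N n ∸ E) ≡ 2 * suc d + N n
    offset = begin
        3 + 2 * toℕ j + (N n ∸ E)
      ≡⟨ cong (λ m → 3 + 2 * m + (N n ∸ E)) (sym t+d≡j) ⟩
        3 + 2 * (toℕ t + d) + (N n ∸ E)
      ≡⟨ identity (toℕ t) d (N n ∸ E) ⟩
        2 * suc d + (E + (N n ∸ E))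
      ≡⟨ cong (2 * suc d +_) (m+[n∸m]≡n E≤N) ⟩
        2 * suc d + N n
      ∎
      where
      open ≡-Reasoning
      open +-*-Solver
      identity : ∀ t d x → 3 + 2 * (t + d) + x ≡ 2 * suc d + (suc (2 * t) + x)
      identity = solve 3 (λ t d x → con 3 :+ con 2 :* (t :+ d) :+ x
                                    := con 2 :* (con 1 :+ d) :+ ((con 1 :+ con 2 :* t) :+ x)) refl
    loopLen≡ : loopLen n E (upperEnd j) ≡ 2 * suc d
    loopLen≡ = loopLen-≡ n E (upperEnd j) _ (s≤s z≤n) L≤N
      (trans (loopLen-upperEnd n j E E≤N) (trans (cong (_% N n) offset) ([m+n]%n≡m%n (2 * suc d) (N n))))
    subpath≡ : subpath n E (2 * suc d) ≡ walk (take (suc d) (stepsFrom t))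
    subpath≡ = begin
        take (2 * suc d) (drop E (pathTwice n))
      ≡⟨ cong (take (2 * suc d)) (drop-pathEdges t (pathEdges n)) ⟩
        take (2 * suc d) (walk (stepsFrom t) ++ pathEdges n)
      ≡⟨ take-walk-suc (suc d) (drop (toℕ t) F) (pathEdges n) 1+d≤ ⟩
        walk (map suc (take (suc d) (drop (toℕ t) F)))
      ≡⟨ cong walk (sym (take-map (suc d) (drop (toℕ t) F))) ⟩
        walk (take (suc d) (stepsFrom t))
      ∎
      where open ≡-Reasoning
    length≡ : length (take (suc d) (stepsFrom t)) ≡ suc d
    length≡ = trans (length-take (suc d) (stepsFrom t))
      (m≤n⇒m⊓n≡m (subst (suc d ≤_) (sym (length-map suc (drop (toℕ t) F))) 1+d≤))
    ends : take (suc d) (stepsFrom t) ≡ map suc (drop (toℕ t) (take (toℕ j) F)) ++ suc j ∷ []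
    ends = begin
        take (suc d) (map suc (drop (toℕ t) F))
      ≡⟨ take-map (suc d) (drop (toℕ t) F) ⟩
        map suc (take (suc d) (drop (toℕ t) F))
      ≡⟨ cong (map suc) (take-drop (suc d) (toℕ t) F) ⟩
        map suc (drop (toℕ t) (take (toℕ t + suc d) F))
      ≡⟨ cong (λ m → map suc (drop (toℕ t) (take m F))) (trans (+-suc (toℕ t) d) (cong suc t+d≡j)) ⟩
        map suc (drop (toℕ t) (take (suc (toℕ j)) F))
      ≡⟨ cong (λ ts → map suc (drop (toℕ t) ts)) (take-suc-tabulate id j) ⟩
        map suc (drop (toℕ t) (take (toℕ j) F ++ j ∷ []))
      ≡⟨ cong (map suc) (drop-++ˡ (toℕ t) (take (toℕ j) F) (j ∷ []) t≤) ⟩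
        map suc (drop (toℕ t) (take (toℕ j) F) ++ j ∷ [])
      ≡⟨ map-++ suc (drop (toℕ t) (take (toℕ j) F)) (j ∷ []) ⟩
        map suc (drop (toℕ t) (take (toℕ j) F)) ++ suc j ∷ []
      ∎
      where
      open ≡-Reasoning
      t≤ : toℕ t ≤ length (take (toℕ j) F)
      t≤ = subst (toℕ t ≤_)
        (sym (trans (length-take (toℕ j) F) (m≤n⇒m⊓n≡m (subst (toℕ j ≤_) (sym (length-allFin n)) (<⇒≤ (toℕ<n j))))))
        (subst (toℕ t ≤_) t+d≡j (m≤m+n (toℕ t) d))

  wrap-window : ∀ t j → toℕ j < toℕ t → Window (suc t) j
  wrap-window t j j<t = window-from (stepsFrom t ++ stepsUpTo j) _
    (cong (_++ stepsUpTo j) (stepsFrom-starts t))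
    (Linked.++⁺ (stepsFrom-linked t) (connected-to-step₀ _) (stepsUpTo-linked j))
    (stepsFrom t ++ zero ∷ map suc (take (toℕ j) (allFin n)) ,
      trans (cong (stepsFrom t ++_) (stepsUpTo-ends j)) (sym (++-assoc (stepsFrom t) _ (suc j ∷ []))))
    (≤-reflexive (trans (count-++ isStep₀ (stepsFrom t) (stepsUpTo j))
      (cong₂ _+_ (count-isStep₀-map-suc (drop (toℕ t) (allFin n))) (count-isStep₀-stepsUpTo j))))
    (trans (cong (subpath n E) loopLen≡) subpath≡)
    (λ 1+t≤1+j → ⊥-elim (<⇒≱ j<t (≤-pred 1+t≤1+j)))
    where
    E = leftEnd (suc t)
    L = 3 + 2 * toℕ j + (N n ∸ E)
    E≤N : E ≤ N n
    E≤N = <⇒≤ (leftEnd<N (suc t))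
    L≤N : L ≤ N n
    L≤N = begin
      3 + 2 * toℕ j + (N n ∸ E)   ≤⟨ +-monoˡ-≤ (N n ∸ E) (s≤s (subst (_≤ 2 * toℕ t) (*-suc 2 (toℕ j)) (*-monoʳ-≤ 2 j<t))) ⟩
      E + (N n ∸ E)               ≡⟨ m+[n∸m]≡n E≤N ⟩
      N n                         ∎
      where open ≤-Reasoning
    loopLen≡ : loopLen n E (upperEnd j) ≡ L
    loopLen≡ = loopLen-≡ n E (upperEnd j) L (s≤s z≤n) L≤N (loopLen-upperEnd n j E E≤N)
    L≡ : L ≡ length (walk (stepsFrom t)) + (3 + 2 * toℕ j)
    L≡ = trans (+-comm (3 + 2 * toℕ j) _) (cong (_+ (3 + 2 * toℕ j)) (trans (N∸leftEnd t)
      (sym (trans (length-walk-suc (drop (toℕ t) (allFin n))) (cong (2 *_) (length-drop-allFin (toℕ t)))))))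
    subpath≡ : subpath n E L ≡ walk (stepsFrom t ++ stepsUpTo j)
    subpath≡ = begin
        take L (drop E (pathTwice n))
      ≡⟨ cong (take L) (drop-pathEdges t (pathEdges n)) ⟩
        take L (walk (stepsFrom t) ++ pathEdges n)
      ≡⟨ cong (λ m → take m (walk (stepsFrom t) ++ pathEdges n)) L≡ ⟩
        take (length (walk (stepsFrom t)) + (3 + 2 * toℕ j)) (walk (stepsFrom t) ++ pathEdges n)
      ≡⟨ take-++-length (walk (stepsFrom t)) (pathEdges n) (3 + 2 * toℕ j) ⟩
        walk (stepsFrom t) ++ take (3 + 2 * toℕ j) (pathEdges n)
      ≡⟨ cong (λ ps → walk (stepsFrom t) ++ take (3 + 2 * toℕ j) ps) (sym (++-identityʳ (pathEdges n))) ⟩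
        walk (stepsFrom t) ++ take (3 + 2 * toℕ j) (pathEdges n ++ [])
      ≡⟨ cong (walk (stepsFrom t) ++_) (take-pathEdges j []) ⟩
        walk (stepsFrom t) ++ walk (stepsUpTo j)
      ≡⟨ sym (concatMap-++ step (stepsFrom t) (stepsUpTo j)) ⟩
        walk (stepsFrom t ++ stepsUpTo j)
      ∎
      where open ≡-Reasoning

  window : ∀ (i : Fin (suc n)) (j : Fin n) → Window i j
  window zero j = origin-window j
  window (suc t) j with toℕ t ≤? toℕ j
  ... | yes t≤j = let d , t+d≡j = m≤n⇒∃[o]m+o≡n t≤j in forward-window t j d t+d≡j
  ... | no t≰j = wrap-window t j (≰⇒> t≰j)

-- Compatibility

module _ {n : ℕ} (S₁ : Vec Bool (suc n)) (S₂ : Vec Bool n) where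

  private
    pathLength : Fin (suc n) → Fin n → ℕ
    pathLength i j = loopLen n (leftEnd i) (upperEnd j)

    Cond : List (Edge n) → List (Edge n) → Set
    Cond AF EA = (count isH AF ≡ 2 * count (inS₂ S₂) AF) ⊎ (count isV EA ≡ 2 * count (inS₁ S₁) EA)

    pathLength≤N : ∀ i j → pathLength i j ≤ N n
    pathLength≤N i j = loopLen≤N n (leftEnd i) (upperEnd j)

    length-framed : ∀ i j (M : List (Edge n)) → length (hor i ∷ (M ++ ver j ∷ [])) ≡ suc (suc (length M))
    length-framed i j M = cong suc (trans (length-++ M) (+-comm (length M) 1))

  BalancedAt⇒PointCond : ∀ i j k → k ≤ pathLength i j →
    BalancedAt S₁ S₂ (subpath n (leftEnd i) (pathLength i j)) k → PointCond n S₁ S₂ i j k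
  BalancedAt⇒PointCond i j k k≤ = subst₂ Cond
    (sym (subpath-suffix n (leftEnd<N i) (pathLength≤N i j) k k≤)) (sym (subpath-prefix n (leftEnd<N i) (pathLength≤N i j) k k≤))

  PointCond⇒BalancedAt : ∀ i j k → k ≤ pathLength i j →
    PointCond n S₁ S₂ i j k → BalancedAt S₁ S₂ (subpath n (leftEnd i) (pathLength i j)) k
  PointCond⇒BalancedAt i j k k≤ = subst₂ Cond
    (subpath-suffix n (leftEnd<N i) (pathLength≤N i j) k k≤) (subpath-prefix n (leftEnd<N i) (pathLength≤N i j) k k≤)

  independent⇒compatible : ¬ Clash S₁ S₂ → Compatible n S₁ S₂
  independent⇒compatible noClash i j u∈S₁ v∈S₂ =
    fromℕ< k<L , subst (1 ≤_) (sym (toℕ-fromℕ< k<L)) (s≤s z≤n) ,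
    subst (PointCond n S₁ S₂ i j) (sym (toℕ-fromℕ< k<L)) (BalancedAt⇒PointCond i j (suc k) (<⇒≤ k<L) balanced)
    where
    open Window (window i j)
    M = proj₁ (walk-from-to i j later ends-at)
    subpath≡ : subpath n (leftEnd i) (pathLength i j) ≡ hor i ∷ (M ++ ver j ∷ [])
    subpath≡ = trans subpath≡walk (proj₂ (walk-from-to i j later ends-at))
    found = balanced-in-window S₁ S₂ noClash (window i j) u∈S₁ v∈S₂ M (proj₂ (walk-from-to i j later ends-at))
    k = proj₁ found
    balanced : BalancedAt S₁ S₂ (subpath n (leftEnd i) (pathLength i j)) (suc k)
    balanced = subst (λ W → BalancedAt S₁ S₂ W (suc k)) (sym subpath≡) (proj₂ (proj₂ found))
    k<L : suc k < pathLength i j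
    k<L = subst (suc k <_) (trans (sym (length-framed i j M)) (trans (cong length (sym subpath≡))
                                   (length-subpath n (leftEnd<N i) (pathLength≤N i j))))
                (s≤s (s≤s (proj₁ (proj₂ found))))

  short-window-incompatible : ∀ i j → lookup S₁ i ≡ true → lookup S₂ j ≡ true →
    length (i ∷ Window.later (window i j)) ≤ 2 → ¬ Compatible n S₁ S₂
  short-window-incompatible i j u∈S₁ v∈S₂ short compatible =
    let k , 1≤k , cond = compatible i j u∈S₁ v∈S₂ in no-inner-point (toℕ k) (toℕ<n k) 1≤k cond
    where
    open Window (window i j)
    M = proj₁ (walk-from-to i j later ends-at)
    walk≡ = proj₂ (walk-from-to i j later ends-at)
    subpath≡ : subpath n (leftEnd i) (pathLength i j) ≡ hor i ∷ (M ++ ver j ∷ [])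
    subpath≡ = trans subpath≡walk walk≡
    H≤1 : count isH M ≤ 1
    H≤1 = +-cancelʳ-≤ 1 _ _ (subst (_≤ 2) (sym (horizontal-count later M walk≡)) short)
    V≤1 : count isV M ≤ 1
    V≤1 = +-cancelʳ-≤ 1 _ _ (m+n≤o⇒m≤o (count isV M + 1) (subst (_≤ 2) (sym (vertical-count later M walk≡)) short))
    no-inner-point : ∀ m → m < pathLength i j → 1 ≤ m → ¬ PointCond n S₁ S₂ i j m
    no-inner-point (suc k) k< _ cond = no-balance-in-short-window S₁ S₂ u∈S₁ v∈S₂ M V≤1 H≤1 k
      (≤-pred (≤-pred (subst (suc k <_) (trans (sym (length-subpath n (leftEnd<N i) (pathLength≤N i j)))
                                             (trans (cong length subpath≡) (length-framed i j M))) k<)))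
      (subst (λ W → BalancedAt S₁ S₂ W (suc k)) subpath≡ (PointCond⇒BalancedAt i j (suc k) (<⇒≤ k<) cond))

  clash⇒incompatible : Clash S₁ S₂ → ¬ Compatible n S₁ S₂
  clash⇒incompatible (j , v∈S₂ , inj₁ u∈S₁) =
    short-window-incompatible (suc j) j u∈S₁ v∈S₂ (≤-trans (≤-reflexive length≡1) (n≤1+n 1))
    where
    length≡1 : length (suc j ∷ Window.later (window (suc j) j)) ≡ 1
    length≡1 = +-cancelʳ-≡ (suc (toℕ j)) _ 1 (Window.length-forward (window (suc j) j) ≤-refl)
  clash⇒incompatible (j , v∈S₂ , inj₂ u∈S₁) =
    short-window-incompatible (inject₁ j) j u∈S₁ v∈S₂ (≤-reflexive length≡2)
    where
    length≡2 : length (inject₁ j ∷ Window.later (window (inject₁ j) j)) ≡ 2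
    length≡2 = +-cancelʳ-≡ (toℕ j) _ 2
      (trans (cong (length (inject₁ j ∷ Window.later (window (inject₁ j) j)) +_) (sym (toℕ-inject₁ j)))
      (Window.length-forward (window (inject₁ j) j) (≤-trans (≤-reflexive (toℕ-inject₁ j)) (n≤1+n _))))

compatible?≡independent : ∀ n (S₁ : Vec Bool (suc n)) S₂ → does (compatible? n S₁ S₂) ≡ independent S₁ S₂
compatible?≡independent n S₁ S₂ with independent S₁ S₂ in ind
... | true = dec-true (compatible? n S₁ S₂) (independent⇒compatible S₁ S₂ (independent-sound S₁ S₂ ind))
... | false = dec-false (compatible? n S₁ S₂) (clash⇒incompatible S₁ S₂ (independent-complete S₁ S₂ ind))

numCompatible≡numIndependent : ∀ n → numCompatible n ≡ numIndependent n
numCompatible≡numIndependent n = begin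
    numCompatible n
  ≡⟨ length-filter≡sumOver (λ p → compatible? n (proj₁ p) (proj₂ p)) (cartesianProduct (allVecs (suc n)) (allVecs n)) ⟩
    sumOver (λ p → 𝟙 (does (compatible? n (proj₁ p) (proj₂ p)))) (cartesianProduct (allVecs (suc n)) (allVecs n))
  ≡⟨ sumOver-cartesianProduct _ (allVecs (suc n)) (allVecs n) ⟩
    sumOver (λ S₁ → sumOver (λ S₂ → 𝟙 (does (compatible? n S₁ S₂))) (allVecs n)) (allVecs (suc n))
  ≡⟨ sumOver-cong (λ S₁ → sumOver-cong (λ S₂ → cong 𝟙 (compatible?≡independent n S₁ S₂)) (allVecs n)) (allVecs (suc n)) ⟩
    numIndependent n
  ∎
  where open ≡-Reasoning

mainTheorem10 : ((n : ℕ) → 1 < n → numCompatible n + numCompatible (n ∸ 2) ≡ 3 * numCompatible (n ∸ 1))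
                × ((n : ℕ) → numCompatible n ≡ fib (2 * n + 3))
mainTheorem10 = recurrence , closed-form
  where
  closed-form : ∀ n → numCompatible n ≡ fib (2 * n + 3)
  closed-form n = trans (numCompatible≡numIndependent n) (numIndependent≡fib n)
  index-suc : ∀ m → 2 * suc m + 3 ≡ 2 + (2 * m + 3)
  index-suc m = cong (_+ 3) (*-suc 2 m)
  recurrence : ∀ n → 1 < n → numCompatible n + numCompatible (n ∸ 2) ≡ 3 * numCompatible (n ∸ 1)
  recurrence (suc zero) (s≤s ())
  recurrence (suc (suc m)) _ = begin
      numCompatible (2 + m) + numCompatible m
    ≡⟨ cong₂ _+_ (trans (closed-form (2 + m)) (cong fib (trans (index-suc (suc m)) (cong (2 +_) (index-suc m)))))
                 (closed-form m) ⟩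
      fib (4 + (2 * m + 3)) + fib (2 * m + 3)
    ≡⟨ fib-+4 (2 * m + 3) ⟩
      3 * fib (2 + (2 * m + 3))
    ≡⟨ cong (3 *_) (sym (trans (closed-form (suc m)) (cong fib (index-suc m)))) ⟩
      3 * numCompatible (suc m)
    ∎
    where open ≡-Reasoning
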